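{- Let $G$ be a finite undirected graph and let $C=\{C_0,C_1,\dots,C_k\}$ be an ordered clique cover of $G$. Then $W(C)\ge \lceil s(G)/2\rceil-1$.
   Context: A clique cover of $G$ is a set of pairwise vertex-disjoint cliques of $G$ such that every vertex lies in exactly one of them, listed in the given order. Its width is $W(C)=\max\{|j-i| : xy\in E(G),\ x\in C_i,\ y\in C_j\}$. $s(G)$ denotes the number of leaves of a largest induced star (induced subgraph isomorphic to $K_{1,s}$) in $G$; when $|V(G)|\le 2$, $s(G)=1$ by convention. -}

module Defs where

open import Data.Nat using (ℕ; zero; suc; _≤_; ∣_-_∣)
open import Data.Fin using (Fin; toℕ)
open import Data.Product using (Σ; _×_; _,_; ∃)
open import Data.Sum using (_⊎_)
open import Relation.Nullary using (¬_)
open import Relation.Binary.PropositionalEquality using (_≡_; _≢_)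
open import Function.Definitions using (Injective; Surjective)

record Graph : Set₁ where
  field
    n      : ℕ
    E      : Fin n → Fin n → Set
    sym    : ∀ {x y} → E x y → E y x
    irrefl : ∀ {x} → ¬ E x x
open Graph public

record InducedStar (G : Graph) (t : ℕ) : Set where
  field
    centre    : Fin (n G)
    leaf      : Fin t → Fin (n G)
    leaf-inj  : Injective _≡_ _≡_ leaf
    adj       : ∀ i → E G centre (leaf i)
    indep     : ∀ i j → ¬ E G (leaf i) (leaf j)

IsStarNumber : Graph → ℕ → Set
IsStarNumber G s =
  (n G ≤ 2 × s ≡ 1) ⊎
  (¬ (n G ≤ 2) × InducedStar G s × (∀ t → InducedStar G t → t ≤ s))

-- An ordered clique cover C_0, …, C_k given by the index map c : V → Fin (suc k)
-- (vertex x lies in C_(c x)); this makes the cliques pairwise disjoint and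
-- covering.
record CliqueCover (G : Graph) (k : ℕ) : Set where
  field
    cl        : Fin (n G) → Fin (suc k)
    nonempty  : ∀ i → ∃ λ x → cl x ≡ i
    clique    : ∀ x y → cl x ≡ cl y → x ≢ y → E G x y
open CliqueCover public

dist : ∀ {G k} → CliqueCover G k → Fin (n G) → Fin (n G) → ℕ
dist C x y = ∣ toℕ (cl C x) - toℕ (cl C y) ∣

-- W(C) = w : w is the maximum of |j - i| over edges xy, x ∈ C_i, y ∈ C_j
-- (the maximum over the empty set of edges is taken to be 0).
IsWidth : ∀ {G k} → CliqueCover G k → ℕ → Set
IsWidth {G} C w =
  (∀ x y → E G x y → dist C x y ≤ w) ×
  ((w ≡ 0) ⊎ (Σ (Fin (n G)) λ x → Σ (Fin (n G)) λ y → E G x y × dist C x y ≡ w))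

-- The leaves of an induced star are pairwise non-adjacent, so they lie in pairwise
-- distinct cliques; each leaf is adjacent to the centre, so its clique index is within
-- W(C) of the centre's.  At most 2 W(C) + 1 indices fit in that window, so
-- s(G) ≤ 2 W(C) + 1.
module Submission where

open import Defs hiding (sym)
open import Data.Nat using (ℕ; suc; _+_; _∸_; _≤_; _<_; s≤s; z≤n; ⌈_/2⌉; ∣_-_∣)
open import Data.Nat.Properties hiding (_≟_)
open import Data.Fin using (Fin; toℕ; fromℕ<)
open import Data.Fin.Properties using (toℕ-fromℕ<; toℕ-injective; injective⇒≤; _≟_)
open import Data.Product using (_,_)
open import Data.Sum using (inj₁; inj₂)
open import Function using (_∘_)
open import Function.Definitions using (Injective)
open import Relation.Nullary using (yes; no; contradiction)
open import Relation.Binary.PropositionalEquality using (_≡_; refl; cong; sym; module ≡-Reasoning)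

module Window (c w : ℕ) where

  shift : ℕ → ℕ
  shift a = a + w ∸ c

  c≤a+w : ∀ {a} → ∣ c - a ∣ ≤ w → c ≤ a + w
  c≤a+w {a} d = ≤-trans (m≤n+∣m-n∣ c a) (+-monoʳ-≤ a d)

  shift<window : ∀ {a} → ∣ c - a ∣ ≤ w → shift a < suc (w + w)
  shift<window {a} d = s≤s (begin
    a + w ∸ c             ≤⟨ ∸-monoˡ-≤ c (+-monoˡ-≤ w a≤c+w) ⟩
    c + w + w ∸ c         ≡⟨ cong (_∸ c) (+-assoc c w w) ⟩
    c + (w + w) ∸ c       ≡⟨ m+n∸m≡n c (w + w) ⟩
    w + w                 ∎)
    where
    open ≤-Reasoning
    a≤c+w : a ≤ c + w
    a≤c+w = ≤-trans (m≤n+∣m-n∣ a c) (+-monoʳ-≤ c (≤-trans (≤-reflexive (∣-∣-comm a c)) d))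

  shift-injective : ∀ {a b} → ∣ c - a ∣ ≤ w → ∣ c - b ∣ ≤ w → shift a ≡ shift b → a ≡ b
  shift-injective {a} {b} da db e = +-cancelʳ-≡ w a b (begin
    a + w              ≡⟨ sym (m∸n+n≡m (c≤a+w da)) ⟩
    shift a + c        ≡⟨ cong (_+ c) e ⟩
    shift b + c        ≡⟨ m∸n+n≡m (c≤a+w db) ⟩
    b + w              ∎)
    where open ≡-Reasoning

injective-within⇒≤ : ∀ {s} (c w : ℕ) (a : Fin s → ℕ) → Injective _≡_ _≡_ a →
                     (∀ i → ∣ c - a i ∣ ≤ w) → s ≤ suc (w + w)
injective-within⇒≤ c w a a-inj near = injective⇒≤ {f = f} f-inj
  where
  open Window c w
  f : Fin _ → Fin (suc (w + w))
  f i = fromℕ< (shift<window (near i))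
  f-inj : Injective _≡_ _≡_ f
  f-inj {i} {j} e = a-inj (shift-injective (near i) (near j) (begin
    shift (a i)   ≡⟨ sym (toℕ-fromℕ< _) ⟩
    toℕ (f i)     ≡⟨ cong toℕ e ⟩
    toℕ (f j)     ≡⟨ toℕ-fromℕ< _ ⟩
    shift (a j)   ∎))
    where open ≡-Reasoning

leaf-cliques-injective : ∀ {G k t} (C : CliqueCover G k) (S : InducedStar G t) →
                         Injective _≡_ _≡_ (toℕ ∘ cl C ∘ InducedStar.leaf S)
leaf-cliques-injective C S {i} {j} e with i ≟ j
... | yes i≡j = i≡j
... | no i≢j  = contradiction
  (clique C (leaf i) (leaf j) (toℕ-injective e) (i≢j ∘ leaf-inj)) (indep i j)
  where open InducedStar S

≤1+2w⇒⌈/2⌉∸1≤ : ∀ {s} w → s ≤ suc (w + w) → ⌈ s /2⌉ ∸ 1 ≤ w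
≤1+2w⇒⌈/2⌉∸1≤ w s≤ = ≤-trans (∸-monoˡ-≤ 1 (⌈n/2⌉-mono s≤)) (≤-reflexive (sym (n≡⌊n+n/2⌋ w)))

mainTheorem3 : (G : Graph) (k : ℕ) (C : CliqueCover G k) (s w : ℕ) →
               IsStarNumber G s → IsWidth C w → ⌈ s /2⌉ ∸ 1 ≤ w
mainTheorem3 G k C s w (inj₁ (_ , refl)) _ = z≤n
mainTheorem3 G k C s w (inj₂ (_ , S , _)) (edge≤w , _) =
  ≤1+2w⇒⌈/2⌉∸1≤ w (injective-within⇒≤ (toℕ (cl C centre)) w
                     (toℕ ∘ cl C ∘ leaf) (leaf-cliques-injective C S)
                     (λ i → edge≤w centre (leaf i) (adj i)))
  where open InducedStar S
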